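{- Let $a$ and $b$ be two sequences of $n$ distinct integers that are Knuth equivalent. Then $T^\ast(a)$ and $T^\ast(b)$ are Knuth equivalent.
   Context: Standard BBS: boxes indexed by $\mathbf{Z}$ with capacity one, $n$ balls of distinct colors $1,\dots,n$, at most one ball per box. One time step: move the ball of color $1$ to the nearest empty box to its right, then the ball of color $2$, and so on up to color $n$, each ball moved exactly once. A sequence $b=(b_1,\dots,b_n)$ of distinct integers is identified with the state in which the ball of color $k$ is in box $b_k$ (its box-label sequence); $T^\ast(b)$ denotes the box-label sequence of the state obtained from it by one time step. Knuth equivalence: two words are Knuth equivalent if one can be transformed into the other by a finite sequence of elementary Knuth transformations and their inverses, namely replacing three consecutive letters $yzx$ by $yxz$ when $x<y\le z$, or replacing $xzy$ by $zxy$ when $x\le y<z$. -}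

module Defs where

open import Data.Nat using (ℕ; zero; suc)
open import Data.Integer using (ℤ; _+_; _<_; _≤_; +_)
import Data.Integer.Properties as ℤP
open import Data.List using (List; []; _∷_; _++_; [_]; length)
open import Data.List.Membership.DecPropositional ℤP._≟_ using (_∈?_)
open import Relation.Nullary using (yes; no)

-- A state of the BBS with n balls is its box-label sequence
-- b = (b₁,…,bₙ) : ball of colour k sits in box bₖ.

nearestEmptyFuel : ℕ → List ℤ → ℤ → ℤ
nearestEmptyFuel zero    occ x = x + + 1   -- never reached with enough fuel
nearestEmptyFuel (suc f) occ x with (x + + 1) ∈? occ
... | yes _ = nearestEmptyFuel f occ (x + + 1)
... | no  _ = x + + 1

-- Nearest empty box strictly to the right of box x, when the occupied
-- boxes are those listed in occ.  Among the |occ|+1 boxes x+1,…,x+|occ|+1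
-- at least one is empty, so fuel |occ|+1 suffices.
nearestEmpty : List ℤ → ℤ → ℤ
nearestEmpty occ x = nearestEmptyFuel (suc (length occ)) occ x

-- One time step: `done` are the new positions of colours 1..k-1 (already
-- moved), `rest` the current positions of colours k..n (not yet moved).
stepAux : List ℤ → List ℤ → List ℤ
stepAux done []         = done
stepAux done (x ∷ rest) = stepAux (done ++ [ nearestEmpty (done ++ x ∷ rest) x ]) rest

T* : List ℤ → List ℤ
T* b = stepAux [] b

data KnuthElem : List ℤ → List ℤ → Set where
  knuth₁ : ∀ (u v : List ℤ) {x y z : ℤ} → x < y → y ≤ z →
           KnuthElem (u ++ y ∷ z ∷ x ∷ v) (u ++ y ∷ x ∷ z ∷ v)
  knuth₂ : ∀ (u v : List ℤ) {x y z : ℤ} → x ≤ y → y < z →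
           KnuthElem (u ++ x ∷ z ∷ y ∷ v) (u ++ z ∷ x ∷ y ∷ v)

data _≡K_ : List ℤ → List ℤ → Set where
  K-refl  : ∀ {w} → w ≡K w
  K-step  : ∀ {w w′} → KnuthElem w w′ → w ≡K w′
  K-sym   : ∀ {w w′} → w ≡K w′ → w′ ≡K w
  K-trans : ∀ {w w′ w″} → w ≡K w′ → w′ ≡K w″ → w ≡K w″

-- Where a ball lands depends only on the set of occupied boxes.  Hence in a word u ++ t ++ v
-- the balls of u move the same way whatever the order inside t, and the balls of v move the
-- same way as soon as the balls of t end up in the same set of boxes.  So it suffices to follow
-- the three balls of an elementary Knuth move t ↦ t′ among arbitrary other occupied boxes: in
-- both orders they land in the same three boxes, and the two resulting words again differ by an
-- elementary Knuth move.  For yzx ↦ yxz this is because x now stops at or before the box that y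
-- vacated; for xzy ↦ zxy the move obtained is of the second or of the first kind according to
-- whether x stops before z or jumps over it.  Knuth equivalence permutes letters, so the words
-- stay repetition-free along a chain of elementary moves.
module Submission where

open import Defs
open import Data.Nat using (ℕ)
open import Data.Integer using (ℤ)
open import Data.List using (List; length)
open import Data.List.Relation.Unary.Unique.Propositional using (Unique)
open import Relation.Binary.PropositionalEquality using (_≡_)

open import Data.Nat as ℕ using (zero; suc)
import Data.Nat.Properties as ℕ
open import Data.Fin as Fin using (Fin; toℕ)
open import Data.Fin.Properties using (pigeonhole)
open import Data.Integer using (_+_; _<_; _≤_; +_; +<+) renaming (suc to sucℤ)
open import Data.Integer.Properties
open import Data.List using ([]; _∷_; _++_; [_]; lookup)
open import Data.List.Properties using (++-assoc; ++-identityʳ)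
open import Data.List.Membership.Propositional using (_∈_; _∉_)
open import Data.List.Membership.DecPropositional _≟_ using (_∈?_)
open import Data.List.Relation.Unary.Any using (here; there; index)
open import Data.List.Relation.Unary.Any.Properties using (lookup-index)
open import Data.List.Relation.Unary.All using (_∷_)
open import Data.List.Relation.Unary.All.Properties using (¬Any⇒All¬; All¬⇒¬Any)
open import Data.List.Relation.Unary.AllPairs using (_∷_)
open import Data.List.Relation.Binary.Permutation.Propositional
  using (_↭_; ↭-refl; ↭-reflexive; ↭-sym; ↭-trans; prep; swap; ↭⇒↭ₛ)
open import Data.List.Relation.Binary.Permutation.Propositional.Properties
  using (∈-resp-↭; shift; shifts; ++⁺ˡ; ++⁺ʳ; ++-comm; ∷↭∷ʳ)
import Data.List.Relation.Binary.Permutation.Setoid.Properties as ↭ₛ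
open import Data.Product using (_,_)
open import Data.Sum as Sum using (_⊎_; inj₁; inj₂)
open import Data.Empty using (⊥-elim)
open import Function using (_∘_)
open import Relation.Nullary using (¬_; yes; no)
open import Relation.Binary using (tri<; tri≈; tri>)
open import Relation.Binary.PropositionalEquality hiding (_≡_; [_])

private
  variable
    L L′ D D′ d : List ℤ
    f : ℕ
    a b k m x : ℤ

record IsNearestEmpty (L : List ℤ) (x m : ℤ) : Set where
  field
    x<m : x < m
    m∉L : m ∉ L
    gap : ∀ {k} → x < k → k < m → k ∈ L

open IsNearestEmpty

isNearestEmpty-unique : IsNearestEmpty L x a → IsNearestEmpty L x b → a ≡ b
isNearestEmpty-unique {a = a} {b = b} p q with <-cmp a b
... | tri< a<b _ _ = ⊥-elim (m∉L p (gap q (x<m p) a<b))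
... | tri≈ _ a≡b _ = a≡b
... | tri> _ _ b<a = ⊥-elim (m∉L q (gap p (x<m q) b<a))

isNearestEmpty-transfer : (∀ {k} → x < k → k < m → k ∈ L → k ∈ L′) → m ∉ L′ →
                          IsNearestEmpty L x m → IsNearestEmpty L′ x m
isNearestEmpty-transfer within m∉L′ p = record
  { x<m = x<m p ; m∉L = m∉L′ ; gap = λ x<k k<m → within x<k k<m (gap p x<k k<m) }

isNearestEmpty-skip : a ≤ b → (∀ {k} → a < k → k ≤ b → k ∈ L) →
                      IsNearestEmpty L b m → IsNearestEmpty L a m
isNearestEmpty-skip {a} {b} {L} {m} a≤b full p = record
  { x<m = ≤-<-trans a≤b (x<m p) ; m∉L = m∉L p ; gap = gap′ }
  where
  gap′ : ∀ {k} → a < k → k < m → k ∈ L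
  gap′ {k} a<k k<m with k ≤? b
  ... | yes k≤b = full a<k k≤b
  ... | no  k≰b = gap p (≰⇒> k≰b) k<m

private
  x+1≡suc : ∀ x → x + + 1 ≡ sucℤ x
  x+1≡suc x = +-comm x (+ 1)

  x<x+1 : ∀ x → x < x + + 1
  x<x+1 x = suc[i]≤j⇒i<j (≤-reflexive (sym (x+1≡suc x)))

  x<k⇒x+1≤k : x < k → x + + 1 ≤ k
  x<k⇒x+1≤k {x} x<k = subst (_≤ _) (sym (x+1≡suc x)) (i<j⇒suc[i]≤j x<k)

OccupiedRun : ℕ → List ℤ → ℤ → Set
OccupiedRun f L x = (i : Fin f) → x + + suc (toℕ i) ∈ L

occupiedRun-suc : x + + 1 ∈ L → OccupiedRun f L (x + + 1) → OccupiedRun (suc f) L x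
occupiedRun-suc         x+1∈L run Fin.zero    = x+1∈L
occupiedRun-suc {x} {L} x+1∈L run (Fin.suc i) =
  subst (_∈ L) (+-assoc x (+ 1) (+ suc (toℕ i))) (run i)

¬occupiedRun-longer-than-list : ∀ L x → ¬ OccupiedRun (suc (length L)) L x
¬occupiedRun-longer-than-list L x run with pigeonhole (ℕ.n<1+n (length L)) (index ∘ run)
... | i , j , i<j , same-index = <-irrefl same-box (+-monoʳ-< x (+<+ (ℕ.s≤s i<j)))
  where
  open ≡-Reasoning
  same-box : x + + suc (toℕ i) ≡ x + + suc (toℕ j)
  same-box = begin
    x + + suc (toℕ i)        ≡⟨ lookup-index (run i) ⟩
    lookup L (index (run i)) ≡⟨ cong (lookup L) same-index ⟩
    lookup L (index (run j)) ≡⟨ lookup-index (run j) ⟨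
    x + + suc (toℕ j)        ∎

nearestEmptyFuel-correct : ∀ f L x →
                           IsNearestEmpty L x (nearestEmptyFuel f L x) ⊎ OccupiedRun f L x
nearestEmptyFuel-correct zero    L x = inj₂ λ ()
nearestEmptyFuel-correct (suc f) L x with (x + + 1) ∈? L
... | no x+1∉L = inj₁ record
  { x<m = x<x+1 x
  ; m∉L = x+1∉L
  ; gap = λ x<k k<x+1 → ⊥-elim (<⇒≱ k<x+1 (x<k⇒x+1≤k x<k))
  }
... | yes x+1∈L = Sum.map (isNearestEmpty-skip (<⇒≤ (x<x+1 x)) next-occupied)
                          (occupiedRun-suc {x} x+1∈L)
                          (nearestEmptyFuel-correct f L (x + + 1))
  where
  next-occupied : ∀ {k} → x < k → k ≤ x + + 1 → k ∈ L
  next-occupied x<k k≤x+1 = subst (_∈ L) (≤-antisym (x<k⇒x+1≤k x<k) k≤x+1) x+1∈L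

nearestEmpty-correct : ∀ L x → IsNearestEmpty L x (nearestEmpty L x)
nearestEmpty-correct L x = Sum.[ (λ p → p) , ⊥-elim ∘ ¬occupiedRun-longer-than-list L x ]′
                             (nearestEmptyFuel-correct (suc (length L)) L x)

nearestEmpty-≡ : IsNearestEmpty L x m → nearestEmpty L x ≡ m
nearestEmpty-≡ = isNearestEmpty-unique (nearestEmpty-correct _ _)

nearestEmpty-≤ : x < k → k ∉ L → nearestEmpty L x ≤ k
nearestEmpty-≤ {x} {L = L} x<k k∉L =
  ≮⇒≥ λ k<m → k∉L (gap (nearestEmpty-correct L x) x<k k<m)

nearestEmpty-skip : a ≤ b → (∀ {k} → a < k → k ≤ b → k ∈ L) →
                    nearestEmpty L a ≡ nearestEmpty L b
nearestEmpty-skip a≤b full =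
  nearestEmpty-≡ (isNearestEmpty-skip a≤b full (nearestEmpty-correct _ _))

nearestEmpty-resp-↭ : ∀ x → L ↭ L′ → nearestEmpty L x ≡ nearestEmpty L′ x
nearestEmpty-resp-↭ {L} x L↭L′ = sym (nearestEmpty-≡ (isNearestEmpty-transfer
  (λ _ _ → ∈-resp-↭ L↭L′) (m∉L correct ∘ ∈-resp-↭ (↭-sym L↭L′)) correct))
  where
  correct : IsNearestEmpty L x (nearestEmpty L x)
  correct = nearestEmpty-correct L x

∈-replace : ∀ P Q → k ∈ P ++ a ∷ Q → k ≢ a → k ∈ P ++ b ∷ Q
∈-replace []      Q (here k≡a)  k≢a = ⊥-elim (k≢a k≡a)
∈-replace []      Q (there k∈Q) _   = there k∈Q
∈-replace (_ ∷ P) Q (here k≡p)  _   = here k≡p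
∈-replace (_ ∷ P) Q (there k∈)  k≢a = there (∈-replace P Q k∈ k≢a)

nearestEmpty-replace : ∀ x P Q → a ≤ x ⊎ nearestEmpty (P ++ a ∷ Q) x ≤ a →
                       b ≢ nearestEmpty (P ++ a ∷ Q) x →
                       nearestEmpty (P ++ b ∷ Q) x ≡ nearestEmpty (P ++ a ∷ Q) x
nearestEmpty-replace {a} {b} x P Q a-outside b≢m = nearestEmpty-≡ (isNearestEmpty-transfer
  (λ x<k k<m k∈ → ∈-replace P Q k∈ (k≢a x<k k<m))
  (λ m∈ → m∉L correct (∈-replace P Q m∈ (b≢m ∘ sym))) correct)
  where
  correct : IsNearestEmpty (P ++ a ∷ Q) x (nearestEmpty (P ++ a ∷ Q) x)
  correct = nearestEmpty-correct (P ++ a ∷ Q) x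
  k≢a : ∀ {k} → x < k → k < nearestEmpty (P ++ a ∷ Q) x → k ≢ a
  k≢a x<k k<m refl = Sum.[ <⇒≱ x<k , <⇒≱ k<m ] a-outside

nearestEmpty-mono : a ≤ b → (∀ {k} → b < k → k < nearestEmpty L a → k ∈ L → k ∈ L′) →
                    nearestEmpty L a ≤ nearestEmpty L′ b
nearestEmpty-mono {a} {b} {L} {L′} a≤b within = ≮⇒≥ λ m′<m →
  m∉L from-b (within (x<m from-b) m′<m (gap from-a (≤-<-trans a≤b (x<m from-b)) m′<m))
  where
  from-a : IsNearestEmpty L a (nearestEmpty L a)
  from-a = nearestEmpty-correct L a
  from-b : IsNearestEmpty L′ b (nearestEmpty L′ b)
  from-b = nearestEmpty-correct L′ b

-- advance D r: the new boxes of the balls standing in the boxes r, moved one after the other,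
-- when D lists the new boxes of the balls moved before them.
advance : List ℤ → List ℤ → List ℤ
advance D []      = []
advance D (x ∷ r) = let x′ = nearestEmpty (x ∷ r ++ D) x in x′ ∷ advance (x′ ∷ D) r

advance-resp-↭ : ∀ r → D ↭ D′ → advance D r ≡ advance D′ r
advance-resp-↭ []      D↭D′ = refl
advance-resp-↭ (x ∷ r) D↭D′ rewrite nearestEmpty-resp-↭ x (++⁺ˡ (x ∷ r) D↭D′) =
  cong (_ ∷_) (advance-resp-↭ r (prep _ D↭D′))

stepAux-advance : ∀ r → D ↭ d → stepAux d r ≡ d ++ advance D r
stepAux-advance {d = d} [] _ = sym (++-identityʳ d)
stepAux-advance {D} {d} (x ∷ r) D↭d = begin
  stepAux (d ++ [ x′ ]) r              ≡⟨ stepAux-advance r (↭-trans (prep x′ D↭d) (∷↭∷ʳ x′ d)) ⟩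
  (d ++ [ x′ ]) ++ advance (x′ ∷ D) r  ≡⟨ ++-assoc d [ x′ ] _ ⟩
  d ++ x′ ∷ advance (x′ ∷ D) r         ≡⟨ cong (λ x′ → d ++ x′ ∷ advance (x′ ∷ D) r)
                                               (nearestEmpty-resp-↭ x occupied) ⟩
  d ++ advance D (x ∷ r)               ∎
  where
  open ≡-Reasoning
  x′ : ℤ
  x′ = nearestEmpty (d ++ x ∷ r) x
  occupied : d ++ x ∷ r ↭ x ∷ r ++ D
  occupied = ↭-trans (shift x d r) (prep x (↭-trans (++-comm d r) (++⁺ˡ r (↭-sym D↭d))))

T*-advance : ∀ w → T* w ≡ advance [] w
T*-advance w = stepAux-advance w ↭-refl

advance-++ : ∀ t v D →
             advance D (t ++ v) ≡ advance (v ++ D) t ++ advance (advance (v ++ D) t ++ D) v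
advance-++ []      v D = refl
advance-++ (x ∷ t) v D rewrite ++-assoc t v D = cong (x′ ∷_) (begin
  advance (x′ ∷ D) (t ++ v)
    ≡⟨ advance-++ t v (x′ ∷ D) ⟩
  advance (v ++ x′ ∷ D) t ++ advance (advance (v ++ x′ ∷ D) t ++ x′ ∷ D) v
    ≡⟨ cong (λ A → A ++ advance (A ++ x′ ∷ D) v) (advance-resp-↭ t (shift x′ v D)) ⟩
  A ++ advance (A ++ x′ ∷ D) v
    ≡⟨ cong (A ++_) (advance-resp-↭ v (shift x′ A D)) ⟩
  A ++ advance (x′ ∷ A ++ D) v
    ∎)
  where
  open ≡-Reasoning
  x′ : ℤ
  x′ = nearestEmpty (x ∷ t ++ v ++ D) x
  A : List ℤ
  A = advance (x′ ∷ v ++ D) t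

unique-resp-↭ : L ↭ L′ → Unique L → Unique L′
unique-resp-↭ L↭L′ = ↭ₛ.Unique-resp-↭ (setoid ℤ) (↭⇒↭ₛ L↭L′)

advance-unique : ∀ r D → Unique (r ++ D) → Unique (advance D r ++ D)
advance-unique []      D uniq      = uniq
advance-unique (x ∷ r) D (_ ∷ uniq) = unique-resp-↭ (shift x′ (advance (x′ ∷ D) r) D)
  (advance-unique r (x′ ∷ D)
    (unique-resp-↭ (↭-sym (shift x′ r D)) (¬Any⇒All¬ _ (x′∉ ∘ there) ∷ uniq)))
  where
  x′ : ℤ
  x′ = nearestEmpty (x ∷ r ++ D) x
  x′∉ : x′ ∉ x ∷ r ++ D
  x′∉ = m∉L (nearestEmpty-correct (x ∷ r ++ D) x)

∉-∷ : x ≢ a → x ∉ L → x ∉ a ∷ L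
∉-∷ x≢a _   (here x≡a)  = x≢a x≡a
∉-∷ _   x∉L (there x∈L) = x∉L x∈L

advance₃ : ∀ W p q s {a b c} →
           nearestEmpty (p ∷ q ∷ s ∷ W) p ≡ a → nearestEmpty (q ∷ s ∷ a ∷ W) q ≡ b →
           nearestEmpty (s ∷ b ∷ a ∷ W) s ≡ c → advance W (p ∷ q ∷ s ∷ []) ≡ a ∷ b ∷ c ∷ []
advance₃ W p q s refl refl refl = refl

-- mᵢ and nᵢ are the boxes where the i-th moved ball lands when the three balls are moved in the
-- left-hand and in the right-hand order respectively.
advance-knuth₁ : ∀ {W x y z} → x < y → y ≤ z → Unique (y ∷ z ∷ x ∷ W) →
                 KnuthElem (advance W (y ∷ z ∷ x ∷ [])) (advance W (y ∷ x ∷ z ∷ []))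
advance-knuth₁ {W} {x} {y} {z} x<y y≤z ((y≢z ∷ y≢x ∷ y≢W) ∷ _) =
  subst (KnuthElem _) (sym (advance₃ W y x z n₁≡m₁ n₂≡m₃ n₃≡m₂)) (knuth₁ [] [] m₃<m₁ m₁≤m₂)
  where
  m₁ m₂ m₃ n₂ : ℤ
  m₁ = nearestEmpty (y ∷ z ∷ x ∷ W) y
  m₂ = nearestEmpty (z ∷ x ∷ m₁ ∷ W) z
  m₃ = nearestEmpty (x ∷ m₂ ∷ m₁ ∷ W) x
  n₂ = nearestEmpty (x ∷ z ∷ m₁ ∷ W) x
  y<z : y < z
  y<z = ≤∧≢⇒< y≤z y≢z
  y<m₁ : y < m₁
  y<m₁ = x<m (nearestEmpty-correct (y ∷ z ∷ x ∷ W) y)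
  z<m₂ : z < m₂
  z<m₂ = x<m (nearestEmpty-correct (z ∷ x ∷ m₁ ∷ W) z)
  n₁≡m₁ : nearestEmpty (y ∷ x ∷ z ∷ W) y ≡ m₁
  n₁≡m₁ = nearestEmpty-resp-↭ y (prep y (shift z [ x ] W))
  n₂≤y : n₂ ≤ y
  n₂≤y = nearestEmpty-≤ x<y (∉-∷ y≢x (∉-∷ y≢z (∉-∷ (<⇒≢ y<m₁) (All¬⇒¬Any y≢W))))
  n₂≡m₃ : n₂ ≡ m₃
  n₂≡m₃ = sym (nearestEmpty-replace x [ x ] (m₁ ∷ W) (inj₂ (≤-trans n₂≤y y≤z))
                 (≢-sym (<⇒≢ (≤-<-trans n₂≤y (<-trans y<z z<m₂)))))
  m₃<m₁ : m₃ < m₁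
  m₃<m₁ = subst (_< m₁) n₂≡m₃ (≤-<-trans n₂≤y y<m₁)
  m₁≤m₂ : m₁ ≤ m₂
  m₁≤m₂ = nearestEmpty-mono y≤z within
    where
    within : ∀ {k} → z < k → k < m₁ → k ∈ y ∷ z ∷ x ∷ W → k ∈ z ∷ x ∷ m₁ ∷ W
    within z<k _ (here refl)                  = ⊥-elim (<-asym y<z z<k)
    within _   _ (there (here k≡z))           = here k≡z
    within _   _ (there (there (here k≡x)))   = there (here k≡x)
    within _   _ (there (there (there k∈W))) = there (there (there k∈W))
  n₃≡m₂ : nearestEmpty (z ∷ m₃ ∷ m₁ ∷ W) z ≡ m₂
  n₃≡m₂ = nearestEmpty-replace z [ z ] (m₁ ∷ W) (inj₁ (<⇒≤ (<-trans x<y y<z)))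
            (<⇒≢ (<-≤-trans m₃<m₁ m₁≤m₂))

module _ {W : List ℤ} {x y z : ℤ} (x≤y : x ≤ y) (y<z : y < z) where

  private
    m₁ m₂ m₃ : ℤ
    m₁ = nearestEmpty (x ∷ z ∷ y ∷ W) x
    m₂ = nearestEmpty (z ∷ y ∷ m₁ ∷ W) z
    m₃ = nearestEmpty (y ∷ m₂ ∷ m₁ ∷ W) y
    x<z : x < z
    x<z = ≤-<-trans x≤y y<z
    x-lands-at-m₁ : IsNearestEmpty (x ∷ z ∷ y ∷ W) x m₁
    x-lands-at-m₁ = nearestEmpty-correct (x ∷ z ∷ y ∷ W) x
    z<m₂ : z < m₂
    z<m₂ = x<m (nearestEmpty-correct (z ∷ y ∷ m₁ ∷ W) z)

  advance-knuth₂-stopBelow : m₁ < z → Unique (x ∷ z ∷ y ∷ W) →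
    KnuthElem (advance W (x ∷ z ∷ y ∷ [])) (advance W (z ∷ x ∷ y ∷ []))
  advance-knuth₂-stopBelow m₁<z (_ ∷ (z≢y ∷ z≢W) ∷ _) =
    subst (KnuthElem _) (sym (advance₃ W z x y n₁≡m₂ n₂≡m₁ n₃≡m₃)) (knuth₂ [] [] m₁≤m₃ m₃<m₂)
    where
    n₁≡m₂ : nearestEmpty (z ∷ x ∷ y ∷ W) z ≡ m₂
    n₁≡m₂ = trans (nearestEmpty-resp-↭ z (prep z (shift y [ x ] W)))
                  (nearestEmpty-replace z (z ∷ y ∷ []) W (inj₁ (<⇒≤ m₁<z))
                    (<⇒≢ (<-trans x<z z<m₂)))
    n₂≡m₁ : nearestEmpty (x ∷ y ∷ m₂ ∷ W) x ≡ m₁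
    n₂≡m₁ = trans (nearestEmpty-resp-↭ x (prep x (shift m₂ [ y ] W)))
                  (nearestEmpty-replace x [ x ] (y ∷ W) (inj₂ (<⇒≤ m₁<z))
                    (≢-sym (<⇒≢ (<-trans m₁<z z<m₂))))
    n₃≡m₃ : nearestEmpty (y ∷ m₁ ∷ m₂ ∷ W) y ≡ m₃
    n₃≡m₃ = nearestEmpty-resp-↭ y (prep y (shift m₂ [ m₁ ] W))
    m₃<m₂ : m₃ < m₂
    m₃<m₂ = ≤-<-trans (nearestEmpty-≤ y<z z∉) z<m₂
      where
      z∉ : z ∉ y ∷ m₂ ∷ m₁ ∷ W
      z∉ = ∉-∷ z≢y (∉-∷ (<⇒≢ z<m₂) (∉-∷ (≢-sym (<⇒≢ m₁<z)) (All¬⇒¬Any z≢W)))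
    m₁≤m₃ : m₁ ≤ m₃
    m₁≤m₃ = nearestEmpty-mono x≤y within
      where
      within : ∀ {k} → y < k → k < m₁ → k ∈ x ∷ z ∷ y ∷ W → k ∈ y ∷ m₂ ∷ m₁ ∷ W
      within y<k _    (here refl)                  = ⊥-elim (<⇒≱ y<k x≤y)
      within _   k<m₁ (there (here refl))          = ⊥-elim (<-asym k<m₁ m₁<z)
      within _   _    (there (there (here k≡y)))   = here k≡y
      within _   _    (there (there (there k∈W))) = there (there (there k∈W))

  advance-knuth₂-jumpOver : z < m₁ → Unique (x ∷ z ∷ y ∷ W) →
    KnuthElem (advance W (x ∷ z ∷ y ∷ [])) (advance W (z ∷ x ∷ y ∷ []))
  advance-knuth₂-jumpOver z<m₁ ((x≢z ∷ _) ∷ (z≢y ∷ z≢W) ∷ _) =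
    subst₂ KnuthElem (sym (advance₃ W x z y refl refl m₃≡z))
                     (sym (advance₃ W z x y n₁≡m₁ n₂≡z n₃≡m₂))
                     (knuth₁ [] [] z<m₁ m₁≤m₂)
    where
    z∉W : z ∉ W
    z∉W = All¬⇒¬Any z≢W
    inW : ∀ {k} → x < k → k < m₁ → k ≢ y → k ≢ z → k ∈ W
    inW x<k k<m₁ k≢y k≢z with gap x-lands-at-m₁ x<k k<m₁
    ... | here refl                  = ⊥-elim (<-irrefl refl x<k)
    ... | there (here k≡z)           = ⊥-elim (k≢z k≡z)
    ... | there (there (here k≡y))   = ⊥-elim (k≢y k≡y)
    ... | there (there (there k∈W)) = k∈W
    n₁≡m₁ : nearestEmpty (z ∷ x ∷ y ∷ W) z ≡ m₁
    n₁≡m₁ = trans (nearestEmpty-resp-↭ z (shift x [ z ] (y ∷ W)))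
                  (sym (nearestEmpty-skip (<⇒≤ x<z)
                         λ x<k k≤z → gap x-lands-at-m₁ x<k (≤-<-trans k≤z z<m₁)))
    x-lands-at-z : IsNearestEmpty (x ∷ y ∷ m₁ ∷ W) x z
    x-lands-at-z = record
      { x<m = x<z
      ; m∉L = ∉-∷ (≢-sym x≢z) (∉-∷ z≢y (∉-∷ (<⇒≢ z<m₁) z∉W))
      ; gap = between
      }
      where
      between : ∀ {k} → x < k → k < z → k ∈ x ∷ y ∷ m₁ ∷ W
      between {k} x<k k<z with k ≟ y
      ... | yes k≡y = there (here k≡y)
      ... | no  k≢y = there (there (there (inW x<k (<-trans k<z z<m₁) k≢y (<⇒≢ k<z))))
    n₂≡z : nearestEmpty (x ∷ y ∷ m₁ ∷ W) x ≡ z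
    n₂≡z = nearestEmpty-≡ x-lands-at-z
    y-lands-at-z : IsNearestEmpty (y ∷ m₂ ∷ m₁ ∷ W) y z
    y-lands-at-z = record
      { x<m = y<z
      ; m∉L = ∉-∷ z≢y (∉-∷ (<⇒≢ z<m₂) (∉-∷ (<⇒≢ z<m₁) z∉W))
      ; gap = λ y<k k<z → there (there (there
                (inW (≤-<-trans x≤y y<k) (<-trans k<z z<m₁) (≢-sym (<⇒≢ y<k)) (<⇒≢ k<z))))
      }
    m₃≡z : m₃ ≡ z
    m₃≡z = nearestEmpty-≡ y-lands-at-z
    n₃≡m₂ : nearestEmpty (y ∷ z ∷ m₁ ∷ W) y ≡ m₂
    n₃≡m₂ = trans (nearestEmpty-resp-↭ y (shift z [ y ] (m₁ ∷ W)))
                  (nearestEmpty-skip (<⇒≤ y<z) up-to-z)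
      where
      up-to-z : ∀ {k} → y < k → k ≤ z → k ∈ z ∷ y ∷ m₁ ∷ W
      up-to-z {k} y<k k≤z with k ≟ z
      ... | yes k≡z = here k≡z
      ... | no  k≢z = there (there (there
                        (inW (≤-<-trans x≤y y<k) (≤-<-trans k≤z z<m₁) (≢-sym (<⇒≢ y<k)) k≢z)))
    m₁≤m₂ : m₁ ≤ m₂
    m₁≤m₂ = nearestEmpty-mono (<⇒≤ x<z) within
      where
      within : ∀ {k} → z < k → k < m₁ → k ∈ x ∷ z ∷ y ∷ W → k ∈ z ∷ y ∷ m₁ ∷ W
      within z<k _ (here refl)                  = ⊥-elim (<-asym x<z z<k)
      within _   _ (there (here k≡z))           = here k≡z
      within _   _ (there (there (here k≡y)))   = there (here k≡y)
      within _   _ (there (there (there k∈W))) = there (there (there k∈W))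

advance-knuth₂ : ∀ {W x y z} → x ≤ y → y < z → Unique (x ∷ z ∷ y ∷ W) →
                 KnuthElem (advance W (x ∷ z ∷ y ∷ [])) (advance W (z ∷ x ∷ y ∷ []))
advance-knuth₂ {W} {x} {y} {z} x≤y y<z uniq with <-cmp (nearestEmpty (x ∷ z ∷ y ∷ W) x) z
... | tri< m₁<z _ _ = advance-knuth₂-stopBelow x≤y y<z m₁<z uniq
... | tri> _ _ z<m₁ = advance-knuth₂-jumpOver x≤y y<z z<m₁ uniq
... | tri≈ _ m₁≡z _ = ⊥-elim (m∉L (nearestEmpty-correct (x ∷ z ∷ y ∷ W) x) (there (here m₁≡z)))

++-regroup : ∀ (U u s R : List ℤ) → (U ++ u) ++ s ++ R ≡ U ++ (u ++ s) ++ R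
++-regroup U u s R = trans (++-assoc U u (s ++ R)) (cong (U ++_) (sym (++-assoc u s R)))

knuthElem-++ : ∀ U R {w w′} → KnuthElem w w′ → KnuthElem (U ++ w ++ R) (U ++ w′ ++ R)
knuthElem-++ U R (knuth₁ u v x<y y≤z) =
  subst₂ KnuthElem (++-regroup U u _ R) (++-regroup U u _ R) (knuth₁ (U ++ u) (v ++ R) x<y y≤z)
knuthElem-++ U R (knuth₂ u v x≤y y<z) =
  subst₂ KnuthElem (++-regroup U u _ R) (++-regroup U u _ R) (knuth₂ (U ++ u) (v ++ R) x≤y y<z)

knuthElem-↭ : ∀ {w w′} → KnuthElem w w′ → w ↭ w′
knuthElem-↭ (knuth₁ u v {x} {y} {z} _ _) = ++⁺ˡ u (prep y (swap z x ↭-refl))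
knuthElem-↭ (knuth₂ u v {x} {y} {z} _ _) = ++⁺ˡ u (swap x z ↭-refl)

advance-knuthElem-factor : ∀ {t t′} → t ↭ t′ →
  (∀ {W} → Unique (t ++ W) → KnuthElem (advance W t) (advance W t′)) →
  ∀ u v D → Unique ((u ++ t ++ v) ++ D) →
  KnuthElem (advance D (u ++ t ++ v)) (advance D (u ++ t′ ++ v))
advance-knuthElem-factor {t} {t′} t↭t′ factor u v D uniq =
  subst₂ KnuthElem (sym split) (sym split′) (knuthElem-++ U R A→A′)
  where
  open ≡-Reasoning
  U A A′ R : List ℤ
  U  = advance ((t ++ v) ++ D) u
  A  = advance (v ++ U ++ D) t
  A′ = advance (v ++ U ++ D) t′
  R  = advance (A ++ U ++ D) v
  A→A′ : KnuthElem A A′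
  A→A′ = factor (unique-resp-↭ (↭-trans (shifts U (t ++ v)) (↭-reflexive (++-assoc t v (U ++ D))))
                   (advance-unique u ((t ++ v) ++ D) (subst Unique (++-assoc u (t ++ v) D) uniq)))
  split : advance D (u ++ t ++ v) ≡ U ++ A ++ R
  split = trans (advance-++ u (t ++ v) D) (cong (U ++_) (advance-++ t v (U ++ D)))
  split′ : advance D (u ++ t′ ++ v) ≡ U ++ A′ ++ R
  split′ = begin
    advance D (u ++ t′ ++ v)
      ≡⟨ advance-++ u (t′ ++ v) D ⟩
    advance ((t′ ++ v) ++ D) u ++ advance (advance ((t′ ++ v) ++ D) u ++ D) (t′ ++ v)
      ≡⟨ cong (λ U → U ++ advance (U ++ D) (t′ ++ v))
              (advance-resp-↭ u (++⁺ʳ D (++⁺ʳ v (↭-sym t↭t′)))) ⟩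
    U ++ advance (U ++ D) (t′ ++ v)
      ≡⟨ cong (U ++_) (advance-++ t′ v (U ++ D)) ⟩
    U ++ A′ ++ advance (A′ ++ U ++ D) v
      ≡⟨ cong (λ R → U ++ A′ ++ R)
              (advance-resp-↭ v (++⁺ʳ (U ++ D) (↭-sym (knuthElem-↭ A→A′)))) ⟩
    U ++ A′ ++ R
      ∎

advance-knuthElem : ∀ D {w w′} → KnuthElem w w′ → Unique (w ++ D) →
                    KnuthElem (advance D w) (advance D w′)
advance-knuthElem D (knuth₁ u v {x} {y} {z} x<y y≤z) =
  advance-knuthElem-factor (prep y (swap z x ↭-refl)) (advance-knuth₁ x<y y≤z) u v D
advance-knuthElem D (knuth₂ u v {x} {y} {z} x≤y y<z) =
  advance-knuthElem-factor (swap x z ↭-refl) (advance-knuth₂ x≤y y<z) u v D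

T*-knuthElem : ∀ {w w′} → KnuthElem w w′ → Unique w → KnuthElem (T* w) (T* w′)
T*-knuthElem {w} {w′} w→w′ uniq = subst₂ KnuthElem (sym (T*-advance w)) (sym (T*-advance w′))
  (advance-knuthElem [] w→w′ (subst Unique (sym (++-identityʳ w)) uniq))

≡K⇒↭ : ∀ {w w′} → w ≡K w′ → w ↭ w′
≡K⇒↭ K-refl        = ↭-refl
≡K⇒↭ (K-step w→w′) = knuthElem-↭ w→w′
≡K⇒↭ (K-sym w′≡w)  = ↭-sym (≡K⇒↭ w′≡w)
≡K⇒↭ (K-trans p q) = ↭-trans (≡K⇒↭ p) (≡K⇒↭ q)

T*-≡K : ∀ {w w′} → w ≡K w′ → Unique w → T* w ≡K T* w′
T*-≡K K-refl        _    = K-refl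
T*-≡K (K-step w→w′) uniq = K-step (T*-knuthElem w→w′ uniq)
T*-≡K (K-sym w′≡w)  uniq = K-sym (T*-≡K w′≡w (unique-resp-↭ (↭-sym (≡K⇒↭ w′≡w)) uniq))
T*-≡K (K-trans p q) uniq = K-trans (T*-≡K p uniq) (T*-≡K q (unique-resp-↭ (≡K⇒↭ p) uniq))

lemma4p1 : (n : ℕ) (a b : List ℤ) →
           length a ≡ n → length b ≡ n → Unique a → Unique b →
           a ≡K b → T* a ≡K T* b
lemma4p1 _ _ _ _ _ unique-a _ a≡Kb = T*-≡K a≡Kb unique-a
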